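{- Let $G=(V,E,w)$ be a weighted digraph and let $W=\sum_{e\in E} w(e)$. Then $\chi_w(G)\leq 2\lfloor\sqrt{2W}\rfloor+1$.
   Context: A weighted digraph is $G=(V,E,w)$ with $w:E\to[0,1]$. For $S\subseteq V$ and $v\in V$, $d^-_S(v)=\sum_{u\in S,\,(u,v)\in E} w(u,v)$. A $k$-coloring $c:V\to\{1,\dots,k\}$ is a weighted improper $k$-coloring if $d^-_{c[v]}(v)<1$ for all $v$, where $c[v]=\{u: c(u)=c(v)\}$; $\chi_w(G)$ is the minimum such $k$.
   Formalization: The weights $w(e)$ are rational numbers in $[0,1]$ rather than real ones. -}

module Defs where

open import Data.Nat using (ℕ; zero; suc)
open import Data.Integer using (+_)
open import Data.Fin using (Fin; zero; suc)
open import Data.Rational using (ℚ; 0ℚ; 1ℚ; _+_; _*_; _≤_; _<_; _/_)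
open import Data.Product using (_×_; ∃)
open import Relation.Binary.PropositionalEquality using (_≡_)
open import Relation.Nullary using (does)
open import Data.Fin using (_≟_)
open import Data.Bool using (if_then_else_)

-- A weighted digraph on vertex set V = Fin n: w u v is the weight of the
-- arc (u,v), with w u v = 0 meaning "no arc" (arcs of weight 0 contribute
-- nothing to any quantity in the statement).
record WeightedDigraph (n : ℕ) : Set where
  field
    w      : Fin n → Fin n → ℚ
    w-≥0   : ∀ u v → 0ℚ ≤ w u v
    w-≤1   : ∀ u v → w u v ≤ 1ℚ
    noLoop : ∀ v → w v v ≡ 0ℚ
open WeightedDigraph public

sumFin : (n : ℕ) → (Fin n → ℚ) → ℚ
sumFin zero    f = 0ℚ
sumFin (suc n) f = f zero + sumFin n (λ i → f (suc i))

totalWeight : ∀ {n} → WeightedDigraph n → ℚ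
totalWeight {n} G = sumFin n (λ u → sumFin n (λ v → w G u v))

inDegSameColour : ∀ {n k} → WeightedDigraph n → (Fin n → Fin k) → Fin n → ℚ
inDegSameColour {n} G c v =
  sumFin n (λ u → if does (c u ≟ c v) then w G u v else 0ℚ)

IsWeightedImproperColouring : ∀ {n k} → WeightedDigraph n → (Fin n → Fin k) → Set
IsWeightedImproperColouring G c = ∀ v → inDegSameColour G c v < 1ℚ

ChiWAtMost : ∀ {n} → WeightedDigraph n → ℕ → Set
ChiWAtMost {n} G k = ∃ λ (c : Fin n → Fin k) → IsWeightedImproperColouring G c

ℕtoℚ : ℕ → ℚ
ℕtoℚ m = (+ m) / 1

IsFloorSqrt : ℚ → ℕ → Set
IsFloorSqrt x m = (ℕtoℚ m * ℕtoℚ m ≤ x) × (x < ℕtoℚ (suc m) * ℕtoℚ (suc m))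

{-# OPTIONS --safe #-}
-- Call v heavy if its degree deg v = d⁻(v) + d⁺(v) is at least m + 1. The degrees sum to
-- 2W < (m + 1)², so at most m vertices are heavy, and they get pairwise distinct private
-- colours. The light vertices take one of m + 1 further colours, chosen to minimise the total
-- weight Φ of monochromatic arcs. Moving a light vertex v to colour j changes Φ by the weight
-- of the arcs between v and class j minus the monochromatic weight at v, so by minimality the
-- latter is at most the former for every j. The m + 1 classes are disjoint, so summing over j
-- gives (m + 1) · (monochromatic weight at v) ≤ deg v < m + 1.
module Submission where

open import Defs

import Algebra.Solver.CommutativeMonoid as CommutativeMonoidSolver
import Data.Nat.Coprimality as Coprime
open import Data.Bool.Base using (Bool; true; false; if_then_else_)
open import Data.Empty using (⊥-elim-irr)
open import Data.Fin.Base using (Fin; zero; suc; _↑ˡ_; _↑ʳ_; inject≤; splitAt)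
open import Data.Fin.Properties
  using (_≟_; 0≢1+n; suc-injective; ↑ˡ-injective; ↑ʳ-injective; inject≤-injective; splitAt-↑ˡ; splitAt-↑ʳ)
import Data.Integer.Base as ℤ
import Data.Integer.Properties as ℤ
open import Data.Nat.Base as ℕ using (ℕ; zero; suc; _*_; z≤n; s≤s)
import Data.Nat.Properties as ℕ
open import Data.Product.Base using (∃; _,_; proj₁; proj₂)
open import Data.Rational.Base using (ℚ; mkℚ; 0ℚ; 1ℚ; _+_; -_; _≤_; _<_; _/_)
import Data.Rational as Q
import Data.Rational.Properties as ℚ
open import Data.Sum.Base using (inj₁; inj₂; [_,_]′)
open import Data.Vec.Functional using (_∷_; head; tail; updateAt)
open import Data.Vec.Functional.Properties using (∷-cong; updateAt-updates; updateAt-minimal)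
open import Function.Base using (_∘_; const)
open import Function.Definitions using (Injective)
open import Level using (Level)
open import Relation.Binary.Bundles using (TotalPreorder)
open import Relation.Binary.PropositionalEquality hiding ([_])
open import Relation.Nullary using (¬_; Dec; yes; no; does; contradiction)
open import Relation.Nullary.Decidable using (toSum)
open import Relation.Unary using (Pred; Decidable)

open import Algebra.Properties.CommutativeMonoid.Sum ℚ.+-0-commutativeMonoid
  using (sum; sum-syntax; sum-cong-≗; sum-replicate; sum-replicate-zero; ∑-distrib-+; ∑-comm)
open import Algebra.Properties.Monoid.Mult ℚ.+-0-monoid using (_×_)

private
  variable
    ℓ : Level
    n k : ℕ

+-cancelˡ-≤ : ∀ r {x y} → r + x ≤ r + y → x ≤ y
+-cancelˡ-≤ r {x} {y} r+x≤r+y = subst₂ _≤_ (cancel x) (cancel y) (ℚ.+-monoʳ-≤ (- r) r+x≤r+y)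
  where
  open ≡-Reasoning
  cancel : ∀ z → - r + (r + z) ≡ z
  cancel z = begin
    - r + (r + z)  ≡⟨ ℚ.+-assoc (- r) r z ⟨
    (- r + r) + z  ≡⟨ cong (_+ z) (ℚ.+-inverseˡ r) ⟩
    0ℚ + z         ≡⟨ ℚ.+-identityˡ z ⟩
    z              ∎

p≤p+q : ∀ x {y} → 0ℚ ≤ y → x ≤ x + y
p≤p+q x 0≤y = subst (_≤ x + _) (ℚ.+-identityʳ x) (ℚ.+-monoʳ-≤ x 0≤y)

ℕtoℚ-suc : ∀ a → ℕtoℚ (suc a) ≡ 1ℚ + ℕtoℚ a
ℕtoℚ-suc a = begin
  ℤ.+ suc a / 1                      ≡⟨ cong (λ z → (ℤ.+ 1 ℤ.+ z) / 1) (ℤ.*-identityʳ (ℤ.+ a)) ⟨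
  (ℤ.+ 1 ℤ.+ ℤ.+ a ℤ.* ℤ.+ 1) / 1    ≡⟨⟩
  1ℚ + mkℚ (ℤ.+ a) 0 coprime         ≡⟨ cong (1ℚ +_) (ℚ.normalize-coprime coprime) ⟨
  1ℚ + ℕtoℚ a                        ∎
  where
  open ≡-Reasoning
  coprime : Coprime.Coprime a 1
  coprime = Coprime.sym (Coprime.1-coprimeTo a)

ℕtoℚ*≡× : ∀ a x → ℕtoℚ a Q.* x ≡ a × x
ℕtoℚ*≡× zero    x = ℚ.*-zeroˡ x
ℕtoℚ*≡× (suc a) x = begin
  ℕtoℚ (suc a) Q.* x       ≡⟨ cong (Q._* x) (ℕtoℚ-suc a) ⟩
  (1ℚ + ℕtoℚ a) Q.* x      ≡⟨ ℚ.*-distribʳ-+ x 1ℚ (ℕtoℚ a) ⟩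
  1ℚ Q.* x + ℕtoℚ a Q.* x  ≡⟨ cong₂ _+_ (ℚ.*-identityˡ x) (ℕtoℚ*≡× a x) ⟩
  x + a × x                ∎
  where open ≡-Reasoning

ℕtoℚ≡×1 : ∀ a → ℕtoℚ a ≡ a × 1ℚ
ℕtoℚ≡×1 a = trans (sym (ℚ.*-identityʳ (ℕtoℚ a))) (ℕtoℚ*≡× a 1ℚ)

×-monoʳ-≤ : ∀ a {x y} → x ≤ y → a × x ≤ a × y
×-monoʳ-≤ zero    x≤y = ℚ.≤-refl
×-monoʳ-≤ (suc a) x≤y = ℚ.+-mono-≤ x≤y (×-monoʳ-≤ a x≤y)

×-monoˡ-≤ : ∀ {x} → 0ℚ ≤ x → ∀ {a b} → a ℕ.≤ b → a × x ≤ b × x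
×-monoˡ-≤ 0≤x {b = zero}  z≤n       = ℚ.≤-refl
×-monoˡ-≤ 0≤x {b = suc b} z≤n       = ℚ.+-mono-≤ 0≤x (×-monoˡ-≤ 0≤x {b = b} z≤n)
×-monoˡ-≤ {x} 0≤x         (s≤s a≤b) = ℚ.+-monoʳ-≤ x (×-monoˡ-≤ 0≤x a≤b)

ℕtoℚ-nonNeg : ∀ a → 0ℚ ≤ ℕtoℚ a
ℕtoℚ-nonNeg a = subst (0ℚ ≤_) (sym (ℕtoℚ≡×1 a)) (×-monoˡ-≤ (ℚ.nonNegative⁻¹ 1ℚ) {0} {a} z≤n)

×-cancelʳ-< : ∀ {x} → 0ℚ ≤ x → ∀ a b → a × x < b × x → a ℕ.< b
×-cancelʳ-< 0≤x a b ax<bx with a ℕ.<? b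
... | yes a<b = a<b
... | no  a≮b = contradiction (ℚ.<-≤-trans ax<bx (×-monoˡ-≤ 0≤x (ℕ.≮⇒≥ a≮b))) (ℚ.<-irrefl refl)

×-cancelˡ-< : ∀ a {x y} → a × x < a × y → x < y
×-cancelˡ-< a {x} {y} ax<ay with x ℚ.<? y
... | yes x<y = x<y
... | no  x≮y = contradiction (ℚ.<-≤-trans ax<ay (×-monoʳ-≤ a (ℚ.≮⇒≥ x≮y))) (ℚ.<-irrefl refl)

sumFin≡sum : ∀ n (f : Fin n → ℚ) → sumFin n f ≡ sum f
sumFin≡sum zero    f = refl
sumFin≡sum (suc n) f = cong (f zero +_) (sumFin≡sum n (f ∘ suc))

sum-mono-≤ : {f g : Fin n → ℚ} → (∀ i → f i ≤ g i) → sum f ≤ sum g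
sum-mono-≤ {zero}  f≤g = ℚ.≤-refl
sum-mono-≤ {suc n} f≤g = ℚ.+-mono-≤ (f≤g zero) (sum-mono-≤ (f≤g ∘ suc))

sum-zero : {f : Fin n → ℚ} → (∀ i → f i ≡ 0ℚ) → sum f ≡ 0ℚ
sum-zero {n} f≗0 = trans (sum-cong-≗ f≗0) (sum-replicate-zero n)

sum-nonNeg : {f : Fin n → ℚ} → (∀ i → 0ℚ ≤ f i) → 0ℚ ≤ sum f
sum-nonNeg {n} {f} 0≤f = subst (_≤ sum f) (sum-replicate-zero n) (sum-mono-≤ 0≤f)

infixr 11 [_]·_

[_]·_ : Bool → ℚ → ℚ
[ b ]· x = if b then x else 0ℚ

[]·-zero : ∀ b {x} → x ≡ 0ℚ → [ b ]· x ≡ 0ℚ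
[]·-zero true  x≡0 = x≡0
[]·-zero false _   = refl

[]·-≤ : ∀ {x y} (x≤?y : Dec (x ≤ y)) → 0ℚ ≤ y → [ does x≤?y ]· x ≤ y
[]·-≤ (yes x≤y) _   = x≤y
[]·-≤ (no  _)   0≤y = 0≤y

sum-[]· : ∀ b (f : Fin n → ℚ) → ∑[ i < n ] [ b ]· f i ≡ [ b ]· sum f
sum-[]· true      f = refl
sum-[]· {n} false f = sum-replicate-zero n

sum-[≟]· : ∀ (v : Fin n) (f : Fin n → ℚ) → ∑[ i < n ] [ does (i ≟ v) ]· f i ≡ f v
sum-[≟]· {suc n} zero    f = trans (cong (f zero +_) (sum-replicate-zero n)) (ℚ.+-identityʳ (f zero))
sum-[≟]· {suc n} (suc v) f = trans (ℚ.+-identityˡ _) (sum-[≟]· v (f ∘ suc))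

sum-[]·-unique-≤ : {P : Pred (Fin n) ℓ} (P? : Decidable P) → (∀ {i j} → P i → P j → i ≡ j) →
                   ∀ {x} → 0ℚ ≤ x → ∑[ i < n ] [ does (P? i) ]· x ≤ x
sum-[]·-unique-≤ {n = zero}  P? unique 0≤x = 0≤x
sum-[]·-unique-≤ {n = suc n} P? unique {x} 0≤x with P? zero
... | yes P0 = ℚ.≤-reflexive (trans (cong (x +_) (sum-zero rest≡0)) (ℚ.+-identityʳ x))
  where
  rest≡0 : ∀ i → [ does (P? (suc i)) ]· x ≡ 0ℚ
  rest≡0 i with P? (suc i)
  ... | yes Pi = contradiction (unique P0 Pi) 0≢1+n
  ... | no  _  = refl
... | no  _  = subst (_≤ x) (sym (ℚ.+-identityˡ _))
                 (sum-[]·-unique-≤ (P? ∘ suc) (λ Pi Pj → suc-injective (unique Pi Pj)) 0≤x)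

count : {P : Pred (Fin n) ℓ} → Decidable P → ℕ
count {n = zero}  P? = 0
count {n = suc n} P? with P? zero
... | yes _ = suc (count (P? ∘ suc))
... | no  _ = count (P? ∘ suc)

rank : {P : Pred (Fin n) ℓ} (P? : Decidable P) (i : Fin n) → .(P i) → Fin (count P?)
rank {n = suc n} P? zero    P0 with P? zero
... | yes _   = zero
... | no  ¬P0 = ⊥-elim-irr (¬P0 P0)
rank {n = suc n} P? (suc i) Pi with P? zero
... | yes _ = suc (rank (P? ∘ suc) i Pi)
... | no  _ = rank (P? ∘ suc) i Pi

rank-injective : {P : Pred (Fin n) ℓ} (P? : Decidable P) → ∀ {i j} (Pi : P i) (Pj : P j) →
                 rank P? i Pi ≡ rank P? j Pj → i ≡ j
rank-injective {n = suc n} P? {zero}  {zero}  _  _  _ = refl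
rank-injective {n = suc n} P? {zero}  {suc j} P0 Pj eq with P? zero
... | yes _   = contradiction eq 0≢1+n
... | no  ¬P0 = contradiction P0 ¬P0
rank-injective {n = suc n} P? {suc i} {zero}  Pi P0 eq with P? zero
... | yes _   = contradiction (sym eq) 0≢1+n
... | no  ¬P0 = contradiction P0 ¬P0
rank-injective {n = suc n} P? {suc i} {suc j} Pi Pj eq with P? zero
... | yes _ = cong suc (rank-injective (P? ∘ suc) Pi Pj (suc-injective eq))
... | no  _ = cong suc (rank-injective (P? ∘ suc) Pi Pj eq)

sum-[]·≡count× : {P : Pred (Fin n) ℓ} (P? : Decidable P) (x : ℚ) → ∑[ i < n ] [ does (P? i) ]· x ≡ count P? × x
sum-[]·≡count× {n = zero}  P? x = refl
sum-[]·≡count× {n = suc n} P? x with P? zero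
... | yes _ = cong (x +_) (sum-[]·≡count× (P? ∘ suc) x)
... | no  _ = trans (ℚ.+-identityˡ _) (sum-[]·≡count× (P? ∘ suc) x)

module _ {c ℓ₁ ℓ₂} (O : TotalPreorder c ℓ₁ ℓ₂) where
  open TotalPreorder O renaming (Carrier to B; refl to ≲-refl; trans to ≲-trans)

  argmin : ∀ {p} (h : Fin (suc p) → B) → ∃ λ a → ∀ b → h a ≲ h b
  argmin {zero}  h = zero , λ { zero → ≲-refl }
  argmin {suc p} h with argmin (h ∘ suc)
  ... | a , min with total (h zero) (h (suc a))
  ...   | inj₁ h0≲ = zero  , λ { zero → ≲-refl ; (suc b) → ≲-trans h0≲ (min b) }
  ...   | inj₂ ≲h0 = suc a , λ { zero → ≲h0 ; (suc b) → min b }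

  argmin-→ : ∀ n {p} (Φ : (Fin n → Fin (suc p)) → B) → (∀ {f g} → f ≗ g → Φ f ≈ Φ g) →
             ∃ λ d → ∀ d′ → Φ d ≲ Φ d′
  argmin-→ zero        Φ resp = (λ ()) , λ d′ → reflexive (resp λ ())
  argmin-→ (suc n) {p} Φ resp =
    let a , a-min = argmin (λ a → Φ (a ∷ bestTail a)) in
    (a ∷ bestTail a) , λ d′ →
      ≲-trans (a-min (head d′))
        (≲-trans (proj₂ (minimiseTail (head d′)) (tail d′)) (reflexive (resp (∷-cong refl λ _ → refl))))
    where
    minimiseTail : ∀ a → ∃ λ t → ∀ t′ → Φ (a ∷ t) ≲ Φ (a ∷ t′)
    minimiseTail a = argmin-→ n (λ t → Φ (a ∷ t)) (λ t≗t′ → resp (∷-cong refl t≗t′))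

    bestTail : Fin (suc p) → Fin n → Fin (suc p)
    bestTail a = proj₁ (minimiseTail a)

infixl 6 _[_]≔_

_[_]≔_ : ∀ {A : Set} → (Fin n → A) → Fin n → A → Fin n → A
c [ v ]≔ a = updateAt c v (const a)

sum-exchange-cross : (A A′ : Fin n → Fin n → ℚ) (v : Fin n) →
           (∀ {u x} → u ≢ v → x ≢ v → A u x ≡ A′ u x) → A v v ≡ A′ v v →
           ∑[ u < n ] ∑[ x < n ] A u x + (∑[ u < n ] A′ u v + ∑[ x < n ] A′ v x) ≡
           ∑[ u < n ] ∑[ x < n ] A′ u x + (∑[ u < n ] A u v + ∑[ x < n ] A v x)
sum-exchange-cross {n} A A′ v agree diag = begin
  ∑∑ A + cross A′                                   ≡⟨ sum-plus-cross A A′ ⟨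
  ∑[ u < n ] ∑[ x < n ] (A u x + onCross A′ u x)    ≡⟨ sum-cong-≗ (λ u → sum-cong-≗ (pointwise u)) ⟩
  ∑[ u < n ] ∑[ x < n ] (A′ u x + onCross A u x)    ≡⟨ sum-plus-cross A′ A ⟩
  ∑∑ A′ + cross A                                   ∎
  where
  open ≡-Reasoning
  open CommutativeMonoidSolver ℚ.+-0-commutativeMonoid using (solve; _⊕_; _⊜_; id)

  ∑∑ : (Fin n → Fin n → ℚ) → ℚ
  ∑∑ B = ∑[ u < n ] ∑[ x < n ] B u x

  cross : (Fin n → Fin n → ℚ) → ℚ
  cross B = ∑[ u < n ] B u v + ∑[ x < n ] B v x

  -- The entry (v, v) lies in row v and in column v and is counted twice; hence diag.
  onCross : (Fin n → Fin n → ℚ) → Fin n → Fin n → ℚ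
  onCross B u x = [ does (x ≟ v) ]· B u x + [ does (u ≟ v) ]· B u x

  sum-onCross : ∀ C → ∑[ u < n ] ∑[ x < n ] onCross C u x ≡ cross C
  sum-onCross C = begin
    ∑[ u < n ] ∑[ x < n ] onCross C u x
      ≡⟨ sum-cong-≗ split ⟩
    ∑[ u < n ] (∑[ x < n ] [ does (x ≟ v) ]· C u x + [ does (u ≟ v) ]· sum (C u))
      ≡⟨ ∑-distrib-+ (λ u → ∑[ x < n ] [ does (x ≟ v) ]· C u x) (λ u → [ does (u ≟ v) ]· sum (C u)) ⟩
    ∑[ u < n ] ∑[ x < n ] [ does (x ≟ v) ]· C u x + ∑[ u < n ] [ does (u ≟ v) ]· sum (C u)
      ≡⟨ cong₂ _+_ (sum-cong-≗ (λ u → sum-[≟]· v (C u))) (sum-[≟]· v (sum ∘ C)) ⟩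
    cross C
      ∎
    where
    split : ∀ u → ∑[ x < n ] onCross C u x ≡ ∑[ x < n ] [ does (x ≟ v) ]· C u x + [ does (u ≟ v) ]· sum (C u)
    split u = trans (∑-distrib-+ (λ x → [ does (x ≟ v) ]· C u x) (λ x → [ does (u ≟ v) ]· C u x))
                    (cong (∑[ x < n ] [ does (x ≟ v) ]· C u x +_) (sum-[]· (does (u ≟ v)) (C u)))

  sum-plus-cross : ∀ B C → ∑[ u < n ] ∑[ x < n ] (B u x + onCross C u x) ≡ ∑∑ B + cross C
  sum-plus-cross B C = begin
    ∑[ u < n ] ∑[ x < n ] (B u x + onCross C u x)             ≡⟨ sum-cong-≗ (λ u → ∑-distrib-+ (B u) (onCross C u)) ⟩
    ∑[ u < n ] (sum (B u) + ∑[ x < n ] onCross C u x)         ≡⟨ ∑-distrib-+ (sum ∘ B) (λ u → ∑[ x < n ] onCross C u x) ⟩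
    ∑∑ B + ∑[ u < n ] ∑[ x < n ] onCross C u x                ≡⟨ cong (∑∑ B +_) (sum-onCross C) ⟩
    ∑∑ B + cross C                                            ∎

  pointwise : ∀ u x → A u x + onCross A′ u x ≡ A′ u x + onCross A u x
  pointwise u x with x ≟ v | u ≟ v
  ... | yes refl | yes refl = cong₂ (λ a b → a + (b + b)) diag (sym diag)
  ... | yes refl | no  _    = solve 2 (λ a b → a ⊕ (b ⊕ id) ⊜ b ⊕ (a ⊕ id)) refl (A u x) (A′ u x)
  ... | no  _    | yes refl = solve 2 (λ a b → a ⊕ (id ⊕ b) ⊜ b ⊕ (id ⊕ a)) refl (A u x) (A′ u x)
  ... | no  x≢v  | no  u≢v  = cong (_+ (0ℚ + 0ℚ)) (agree u≢v x≢v)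

module _ (G : WeightedDigraph n) where

  inWeight outWeight degree : Fin n → ℚ
  inWeight  v = ∑[ u < n ] w G u v
  outWeight v = ∑[ x < n ] w G v x
  degree    v = inWeight v + outWeight v

  degree-nonNeg : ∀ v → 0ℚ ≤ degree v
  degree-nonNeg v = ℚ.+-mono-≤ (sum-nonNeg (λ u → w-≥0 G u v)) (sum-nonNeg (w-≥0 G v))

  totalWeight≡sum : totalWeight G ≡ ∑[ u < n ] ∑[ x < n ] w G u x
  totalWeight≡sum = trans (sumFin≡sum n _) (sum-cong-≗ (λ u → sumFin≡sum n (w G u)))

  sum-degree : ∑[ v < n ] degree v ≡ totalWeight G + totalWeight G
  sum-degree = begin
    ∑[ v < n ] degree v                                    ≡⟨ ∑-distrib-+ inWeight outWeight ⟩
    ∑[ v < n ] ∑[ u < n ] w G u v + ∑[ v < n ] outWeight v ≡⟨ cong (_+ ∑[ v < n ] outWeight v) (∑-comm (λ v u → w G u v)) ⟩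
    ∑[ u < n ] ∑[ v < n ] w G u v + ∑[ v < n ] outWeight v ≡⟨ cong₂ _+_ totalWeight≡sum totalWeight≡sum ⟨
    totalWeight G + totalWeight G                          ∎
    where open ≡-Reasoning

  module _ (c : Fin n → Fin k) where

    sameColourArc : Fin n → Fin n → ℚ
    sameColourArc u x = [ does (c u ≟ c x) ]· w G u x

    sameColourTotal : ℚ
    sameColourTotal = ∑[ u < n ] ∑[ x < n ] sameColourArc u x

    sameColourIn sameColourOut : Fin n → ℚ
    sameColourIn  v = ∑[ u < n ] sameColourArc u v
    sameColourOut v = ∑[ x < n ] sameColourArc v x

    inWeightFromColour outWeightToColour : Fin k → Fin n → ℚ
    inWeightFromColour a v = ∑[ u < n ] [ does (c u ≟ a) ]· w G u v
    outWeightToColour  a v = ∑[ x < n ] [ does (a ≟ c x) ]· w G v x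

    inDegSameColour≡sameColourIn : ∀ v → inDegSameColour G c v ≡ sameColourIn v
    inDegSameColour≡sameColourIn v = sumFin≡sum n _

    sameColourArc-diag : ∀ v → sameColourArc v v ≡ 0ℚ
    sameColourArc-diag v = []·-zero (does (c v ≟ c v)) (noLoop G v)

    sameColourOut-nonNeg : ∀ v → 0ℚ ≤ sameColourOut v
    sameColourOut-nonNeg v = sum-nonNeg λ x → arc-nonNeg (does (c v ≟ c x)) (w-≥0 G v x)
      where
      arc-nonNeg : ∀ b {y} → 0ℚ ≤ y → 0ℚ ≤ [ b ]· y
      arc-nonNeg true  0≤y = 0≤y
      arc-nonNeg false _   = ℚ.≤-refl

    sameColourIn-isolated : ∀ v → (∀ {u} → c u ≡ c v → u ≡ v) → sameColourIn v ≡ 0ℚ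
    sameColourIn-isolated v isolated = sum-zero arc≡0
      where
      arc≡0 : ∀ u → sameColourArc u v ≡ 0ℚ
      arc≡0 u with c u ≟ c v
      ... | yes cu≡cv = subst (λ u → w G u v ≡ 0ℚ) (sym (isolated cu≡cv)) (noLoop G v)
      ... | no  _     = refl

    sum-inWeightFromColour : ∀ {p} {g : Fin p → Fin k} → Injective _≡_ _≡_ g →
                             ∀ v → ∑[ j < p ] inWeightFromColour (g j) v ≤ inWeight v
    sum-inWeightFromColour {p} {g} g-inj v = begin
      ∑[ j < p ] ∑[ u < n ] [ does (c u ≟ g j) ]· w G u v  ≡⟨ ∑-comm (λ j u → [ does (c u ≟ g j) ]· w G u v) ⟩
      ∑[ u < n ] ∑[ j < p ] [ does (c u ≟ g j) ]· w G u v  ≤⟨ sum-mono-≤ (λ u → sum-[]·-unique-≤ (λ j → c u ≟ g j)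
                                                                  (λ ei ej → g-inj (trans (sym ei) ej)) (w-≥0 G u v)) ⟩
      inWeight v                                          ∎
      where open ℚ.≤-Reasoning

    sum-outWeightToColour : ∀ {p} {g : Fin p → Fin k} → Injective _≡_ _≡_ g →
                            ∀ v → ∑[ j < p ] outWeightToColour (g j) v ≤ outWeight v
    sum-outWeightToColour {p} {g} g-inj v = begin
      ∑[ j < p ] ∑[ x < n ] [ does (g j ≟ c x) ]· w G v x  ≡⟨ ∑-comm (λ j x → [ does (g j ≟ c x) ]· w G v x) ⟩
      ∑[ x < n ] ∑[ j < p ] [ does (g j ≟ c x) ]· w G v x  ≤⟨ sum-mono-≤ (λ x → sum-[]·-unique-≤ (λ j → g j ≟ c x)
                                                                  (λ ei ej → g-inj (trans ei (sym ej))) (w-≥0 G v x)) ⟩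
      outWeight v                                         ∎
      where open ℚ.≤-Reasoning

  sameColourTotal-cong : {c c′ : Fin n → Fin k} → c ≗ c′ → sameColourTotal c ≡ sameColourTotal c′
  sameColourTotal-cong c≗c′ = sum-cong-≗ λ u → sum-cong-≗ λ x →
    cong₂ (λ s t → [ does (s ≟ t) ]· w G u x) (c≗c′ u) (c≗c′ x)

  module _ (c : Fin n → Fin k) (v : Fin n) (a : Fin k) where

    sameColourTotal-recolour :
      sameColourTotal c + (sameColourIn (c [ v ]≔ a) v + sameColourOut (c [ v ]≔ a) v) ≡
      sameColourTotal (c [ v ]≔ a) + (sameColourIn c v + sameColourOut c v)
    sameColourTotal-recolour = sum-exchange-cross (sameColourArc c) (sameColourArc (c [ v ]≔ a)) v agree
      (trans (sameColourArc-diag c v) (sym (sameColourArc-diag (c [ v ]≔ a) v)))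
      where
      agree : ∀ {u x} → u ≢ v → x ≢ v → sameColourArc c u x ≡ sameColourArc (c [ v ]≔ a) u x
      agree {u} {x} u≢v x≢v = sym (cong₂ (λ s t → [ does (s ≟ t) ]· w G u x)
        (updateAt-minimal u v c u≢v) (updateAt-minimal x v c x≢v))

    sameColourIn-recolour : sameColourIn (c [ v ]≔ a) v ≡ inWeightFromColour c a v
    sameColourIn-recolour = sum-cong-≗ arc
      where
      arc : ∀ u → sameColourArc (c [ v ]≔ a) u v ≡ [ does (c u ≟ a) ]· w G u v
      arc u with u ≟ v
      ... | yes refl = trans (sameColourArc-diag (c [ v ]≔ a) u) (sym ([]·-zero (does (c u ≟ a)) (noLoop G u)))
      ... | no  u≢v  = cong₂ (λ s t → [ does (s ≟ t) ]· w G u v) (updateAt-minimal u v c u≢v) (updateAt-updates v c)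

    sameColourOut-recolour : sameColourOut (c [ v ]≔ a) v ≡ outWeightToColour c a v
    sameColourOut-recolour = sum-cong-≗ arc
      where
      arc : ∀ x → sameColourArc (c [ v ]≔ a) v x ≡ [ does (a ≟ c x) ]· w G v x
      arc x with x ≟ v
      ... | yes refl = trans (sameColourArc-diag (c [ v ]≔ a) x) (sym ([]·-zero (does (a ≟ c x)) (noLoop G x)))
      ... | no  x≢v  = cong₂ (λ s t → [ does (s ≟ t) ]· w G v x) (updateAt-updates v c) (updateAt-minimal x v c x≢v)

  locallyOptimal⇒sameColour≤degree :
    (c : Fin n → Fin k) (v : Fin n) {p : ℕ} {g : Fin p → Fin k} → Injective _≡_ _≡_ g →
    (∀ j → sameColourTotal c ≤ sameColourTotal (c [ v ]≔ g j)) →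
    p × (sameColourIn c v + sameColourOut c v) ≤ degree v
  locallyOptimal⇒sameColour≤degree {k} c v {p} {g} g-inj optimal = begin
    p × X                                           ≡⟨ sum-replicate p ⟨
    ∑[ j < p ] X                                    ≤⟨ sum-mono-≤ X≤recoloured ⟩
    ∑[ j < p ] (inWeightFromColour c (g j) v + outWeightToColour c (g j) v)
      ≡⟨ ∑-distrib-+ (λ j → inWeightFromColour c (g j) v) (λ j → outWeightToColour c (g j) v) ⟩
    ∑[ j < p ] inWeightFromColour c (g j) v + ∑[ j < p ] outWeightToColour c (g j) v
      ≤⟨ ℚ.+-mono-≤ (sum-inWeightFromColour c g-inj v) (sum-outWeightToColour c g-inj v) ⟩
    degree v                                        ∎
    where
    open ℚ.≤-Reasoning
    X : ℚ
    X = sameColourIn c v + sameColourOut c v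

    X≤recoloured : ∀ j → X ≤ inWeightFromColour c (g j) v + outWeightToColour c (g j) v
    X≤recoloured j = +-cancelˡ-≤ (sameColourTotal c′) (begin
      sameColourTotal c′ + X                                        ≡⟨ sameColourTotal-recolour c v (g j) ⟨
      sameColourTotal c + (sameColourIn c′ v + sameColourOut c′ v)  ≤⟨ ℚ.+-monoˡ-≤ _ (optimal j) ⟩
      sameColourTotal c′ + (sameColourIn c′ v + sameColourOut c′ v)
        ≡⟨ cong (sameColourTotal c′ +_) (cong₂ _+_ (sameColourIn-recolour c v (g j)) (sameColourOut-recolour c v (g j))) ⟩
      sameColourTotal c′ + (inWeightFromColour c (g j) v + outWeightToColour c (g j) v) ∎)
      where
      c′ : Fin n → Fin k
      c′ = c [ v ]≔ g j

module _ (G : WeightedDigraph n) (p : ℕ) where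

  Heavy : Fin n → Set
  Heavy v = ℕtoℚ (suc p) ≤ degree G v

  -- Opaque, so that goals mentioning heavy? are never normalised through the gcd inside ℕtoℚ.
  opaque
    heavy? : Decidable Heavy
    heavy? v = ℕtoℚ (suc p) ℚ.≤? degree G v

  count-heavy×≤2W : count heavy? × ℕtoℚ (suc p) ≤ totalWeight G + totalWeight G
  count-heavy×≤2W = begin
    count heavy? × ℕtoℚ (suc p)                     ≡⟨ sum-[]·≡count× heavy? (ℕtoℚ (suc p)) ⟨
    ∑[ v < n ] [ does (heavy? v) ]· ℕtoℚ (suc p)    ≤⟨ sum-mono-≤ heavy≤degree ⟩
    ∑[ v < n ] degree G v                           ≡⟨ sum-degree G ⟩
    totalWeight G + totalWeight G                   ∎
    where
    open ℚ.≤-Reasoning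
    heavy≤degree : ∀ v → [ does (heavy? v) ]· ℕtoℚ (suc p) ≤ degree G v
    heavy≤degree v = []·-≤ (heavy? v) (degree-nonNeg G v)

  count-heavy< : ℕtoℚ 2 Q.* totalWeight G < ℕtoℚ (suc p) Q.* ℕtoℚ (suc p) → count heavy? ℕ.< suc p
  count-heavy< 2W<[p+1]² = ×-cancelʳ-< (ℕtoℚ-nonNeg (suc p)) (count heavy?) (suc p) (begin-strict
    count heavy? × ℕtoℚ (suc p)        ≤⟨ count-heavy×≤2W ⟩
    totalWeight G + totalWeight G      ≡⟨ cong (totalWeight G +_) (ℚ.+-identityʳ (totalWeight G)) ⟨
    2 × totalWeight G                  ≡⟨ ℕtoℚ*≡× 2 (totalWeight G) ⟨
    ℕtoℚ 2 Q.* totalWeight G           <⟨ 2W<[p+1]² ⟩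
    ℕtoℚ (suc p) Q.* ℕtoℚ (suc p)      ≡⟨ ℕtoℚ*≡× (suc p) (ℕtoℚ (suc p)) ⟩
    suc p × ℕtoℚ (suc p)               ∎)
    where open ℚ.≤-Reasoning

  module _ (q : ℕ) (#heavy≤q : count heavy? ℕ.≤ q) where

    lightColour : Fin (suc p) → Fin (suc p ℕ.+ q)
    lightColour j = j ↑ˡ q

    heavyColour : ∀ v → .(Heavy v) → Fin (suc p ℕ.+ q)
    heavyColour v hv = suc p ↑ʳ inject≤ (rank heavy? v hv) #heavy≤q

    heavyColour-injective : ∀ {u v} (hu : Heavy u) (hv : Heavy v) → heavyColour u hu ≡ heavyColour v hv → u ≡ v
    heavyColour-injective hu hv eq =
      rank-injective heavy? hu hv (inject≤-injective _ _ _ _ (↑ʳ-injective (suc p) _ _ eq))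

    light≢heavy : ∀ j {v} (hv : Heavy v) → lightColour j ≢ heavyColour v hv
    light≢heavy j hv eq = contradiction
      (trans (sym (splitAt-↑ˡ (suc p) j q)) (trans (cong (splitAt (suc p)) eq) (splitAt-↑ʳ (suc p) q _)))
      λ ()

    colourAt : ∀ v → Dec (Heavy v) → Fin (suc p) → Fin (suc p ℕ.+ q)
    colourAt v (yes hv) j = heavyColour v hv
    colourAt v (no  _)  j = lightColour j

    colourAt-heavy : ∀ {v} (h? : Dec (Heavy v)) j (hv : Heavy v) → colourAt v h? j ≡ heavyColour v hv
    colourAt-heavy (yes _)   j hv = refl
    colourAt-heavy (no  ¬hv) j hv = contradiction hv ¬hv

    colourAt-light : ∀ {v} (h? : Dec (Heavy v)) j → ¬ Heavy v → colourAt v h? j ≡ lightColour j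
    colourAt-light (yes hv) j ¬hv = contradiction hv ¬hv
    colourAt-light (no  _)  j ¬hv = refl

    colourAt-heavy-injective : ∀ {u v} (h? : Dec (Heavy u)) j (hv : Heavy v) →
                               colourAt u h? j ≡ heavyColour v hv → u ≡ v
    colourAt-heavy-injective (yes hu) j hv eq = heavyColour-injective hu hv eq
    colourAt-heavy-injective (no  _)  j hv eq = contradiction eq (light≢heavy j hv)

    colouring : (Fin n → Fin (suc p)) → Fin n → Fin (suc p ℕ.+ q)
    colouring d v = colourAt v (heavy? v) (d v)

    module _ (d : Fin n → Fin (suc p))
             (d-min : ∀ d′ → sameColourTotal G (colouring d) ≤ sameColourTotal G (colouring d′)) where

      recolour-light : ∀ {v} j → ¬ Heavy v → colouring (d [ v ]≔ j) ≗ colouring d [ v ]≔ lightColour j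
      recolour-light {v} j ¬hv u with u ≟ v
      ... | yes refl = trans (cong (colourAt u (heavy? u)) (updateAt-updates u d))
                         (trans (colourAt-light (heavy? u) j ¬hv) (sym (updateAt-updates u (colouring d))))
      ... | no  u≢v  = trans (cong (colourAt u (heavy? u)) (updateAt-minimal u v d u≢v))
                         (sym (updateAt-minimal u v (colouring d) u≢v))

      heavy-proper : ∀ {v} → Heavy v → sameColourIn G (colouring d) v < 1ℚ
      heavy-proper {v} hv = subst (_< 1ℚ) (sym (sameColourIn-isolated G (colouring d) v isolated)) (ℚ.positive⁻¹ 1ℚ)
        where
        isolated : ∀ {u} → colouring d u ≡ colouring d v → u ≡ v
        isolated {u} cu≡cv = colourAt-heavy-injective (heavy? u) (d u) hv (trans cu≡cv (colourAt-heavy (heavy? v) (d v) hv))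

      light-proper : ∀ {v} → ¬ Heavy v → sameColourIn G (colouring d) v < 1ℚ
      light-proper {v} ¬hv = ℚ.≤-<-trans (p≤p+q _ (sameColourOut-nonNeg G c v)) (×-cancelˡ-< (suc p) (begin-strict
        suc p × (sameColourIn G c v + sameColourOut G c v)
          ≤⟨ locallyOptimal⇒sameColour≤degree G c v (λ {i} {j} → ↑ˡ-injective q i j) optimal-at ⟩
        degree G v    <⟨ ℚ.≰⇒> ¬hv ⟩
        ℕtoℚ (suc p)  ≡⟨ ℕtoℚ≡×1 (suc p) ⟩
        suc p × 1ℚ    ∎))
        where
        open ℚ.≤-Reasoning
        c : Fin n → Fin (suc p ℕ.+ q)
        c = colouring d
        optimal-at : ∀ j → sameColourTotal G c ≤ sameColourTotal G (c [ v ]≔ lightColour j)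
        optimal-at j = subst (sameColourTotal G c ≤_) (sameColourTotal-cong G (recolour-light j ¬hv))
                           (d-min (d [ v ]≔ j))

      minimiser-proper : IsWeightedImproperColouring G (colouring d)
      minimiser-proper v = subst (_< 1ℚ) (sym (inDegSameColour≡sameColourIn G (colouring d) v))
                             ([ heavy-proper , light-proper ]′ (toSum (heavy? v)))

    colouring-by-degree-threshold : ChiWAtMost G (suc p ℕ.+ q)
    colouring-by-degree-threshold with argmin-→ ℚ.≤-totalPreorder n (sameColourTotal G ∘ colouring)
                                         (λ d≗d′ → sameColourTotal-cong G (λ v → cong (colourAt v (heavy? v)) (d≗d′ v)))
    ... | d , d-min = colouring d , minimiser-proper d d-min

theorem3p5 : ∀ {n} (G : WeightedDigraph n) (m : ℕ) →
    IsFloorSqrt (ℕtoℚ 2 Q.* totalWeight G) m →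
    ChiWAtMost G (suc (2 * m))
theorem3p5 G m (_ , 2W<[m+1]²) =
  colouring-by-degree-threshold G m (m ℕ.+ 0) (ℕ.≤-trans (ℕ.s≤s⁻¹ (count-heavy< G m 2W<[m+1]²)) (ℕ.m≤m+n m 0))
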